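{- Let $k,t\geq 0$ and $w\geq 1$ be integers. Every $(w,k,t)$-sum admits a natural layering.
   Context: All graphs are finite and simple. For an integer $k\geq 0$, a \emph{$k$-tree} is defined recursively: a clique on $k$ vertices is a $k$-tree, and a graph obtained from a $k$-tree by adding a new vertex adjacent to all vertices of an existing $k$-clique is a $k$-tree (so $0$-trees are edgeless graphs). The \emph{strong product} $H\boxtimes H'$ has vertex set $V(H)\times V(H')$, with distinct $(u,x),(v,y)$ adjacent iff ($u=v$ or $uv\in E(H)$) and ($x=y$ or $xy\in E(H')$). The \emph{join} $G+H$ is the disjoint union of $G$ and $H$ together with all edges between $V(G)$ and $V(H)$. A \emph{$(k,t)$-summand} is a graph $F=(H\boxtimes P)+K_t$ where $H$ is a $k$-tree and $P$ is a path. A \emph{$(w,k,t)$-sum} is defined recursively: every $(k,t)$-summand is a $(w,k,t)$-sum; if $S$ is a $(w,k,t)$-sum with a clique $Q_S$ of size at most $w$ and $F$ is a $(k,t)$-summand with a clique $Q_F$ with $|Q_F|=|Q_S|$, then the graph obtained from the disjoint union of $S$ and $F$ by identifying the vertices of $Q_S$ with those of $Q_F$ (via a bijection) is a $(w,k,t)$-sum (the cliques may be empty, so sums need not be connected). A partition $L_1,\dots,L_\ell$ of the vertex set of a $(w,k,t)$-sum $S$ with $w\geq1$ is a \emph{natural layering} if: (N1) the first layer $L_1$ (i.e. $S[L_1]$) is a $(0,k,t)$-sum; (N2) if $i\geq 2$ and $C$ is a component of $S[L_i]$, then the set of vertices in $L_{i-1}$ having a neighbor in $C$ is a clique of size at most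 $w$; (N3) for each $i$, $S[L_i]$ is a subgraph of a $(w-1,k,t)$-sum; (N4) for each $i$, vertices in $L_i$ have neighbors only in $L_{i-1}\cup L_i\cup L_{i+1}$. -}

module Defs where

open import Data.Nat using (ℕ; zero; suc; _≤_; _∸_)
open import Data.Nat.Properties using (1+n≢n)
open import Data.Fin using (Fin; toℕ)
open import Data.Maybe using (Maybe; just; nothing)
open import Data.Product using (Σ; ∃; ∃-syntax; _×_; _,_; proj₁; proj₂)
open import Data.Sum using (_⊎_; inj₁; inj₂)
open import Data.Unit using (⊤; tt)
open import Data.Empty using (⊥)
open import Data.List using (List; length)
open import Data.List.Membership.Propositional using (_∈_)
open import Relation.Nullary using (¬_)
open import Relation.Binary.PropositionalEquality using (_≡_; _≢_; refl; sym; cong)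

-- Simple graphs (vertex type arbitrary; all graphs considered below are
-- finite, being isomorphic to / covered by finite graphs).

record Graph : Set₁ where
  field
    V     : Set
    E     : V → V → Set
    E-sym : ∀ {x y} → E x y → E y x
    E-irr : ∀ {x} → ¬ E x x
open Graph public

record _≅_ (G H : Graph) : Set where
  field
    to      : V G → V H
    from    : V H → V G
    from∘to : ∀ x → from (to x) ≡ x
    to∘from : ∀ y → to (from y) ≡ y
    pres    : ∀ x y → E G x y → E H (to x) (to y)
    refl'   : ∀ x y → E H (to x) (to y) → E G x y

Injective : {A B : Set} → (A → B) → Set
Injective f = ∀ x y → f x ≡ f y → x ≡ y

IsCliqueMap : (G : Graph) {q : ℕ} → (Fin q → V G) → Set
IsCliqueMap G Q = Injective Q × (∀ i j → i ≢ j → E G (Q i) (Q j))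

K : ℕ → Graph
K t = record { V = Fin t ; E = λ x y → x ≢ y
             ; E-sym = λ p q → p (sym q) ; E-irr = λ p → p refl }

-- path with n+1 vertices 0 - 1 - ... - n
PathE : {n : ℕ} → Fin n → Fin n → Set
PathE x y = (toℕ x ≡ suc (toℕ y)) ⊎ (toℕ y ≡ suc (toℕ x))

private
  n≢sn : ∀ {n} → n ≢ suc n
  n≢sn p = 1+n≢n (sym p)

Path : ℕ → Graph
Path n = record { V = Fin (suc n) ; E = PathE
                ; E-sym = λ { (inj₁ p) → inj₂ p ; (inj₂ p) → inj₁ p }
                ; E-irr = λ { (inj₁ p) → n≢sn p ; (inj₂ p) → n≢sn p } }

addVertexE : (G : Graph) {q : ℕ} → (Fin q → V G) → Maybe (V G) → Maybe (V G) → Set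
addVertexE G Q (just x) (just y) = E G x y
addVertexE G Q (just x) nothing  = ∃[ i ] Q i ≡ x
addVertexE G Q nothing  (just y) = ∃[ i ] Q i ≡ y
addVertexE G Q nothing  nothing  = ⊥

addVertex : (G : Graph) {q : ℕ} → (Fin q → V G) → Graph
addVertex G Q = record
  { V = Maybe (V G) ; E = addVertexE G Q
  ; E-sym = λ { {just x} {just y} e → E-sym G e
              ; {just x} {nothing} e → e
              ; {nothing} {just y} e → e
              ; {nothing} {nothing} () }
  ; E-irr = λ { {just x} e → E-irr G e ; {nothing} () } }

strongE : (G H : Graph) → V G × V H → V G × V H → Set
strongE G H (u , x) (v , y) =
  ((u , x) ≢ (v , y)) × ((u ≡ v) ⊎ E G u v) × ((x ≡ y) ⊎ E H x y)

_⊠_ : Graph → Graph → Graph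
G ⊠ H = record
  { V = V G × V H ; E = strongE G H
  ; E-sym = λ { (ne , a , b) → (λ eq → ne (sym eq)) , sw G a , sw H b }
  ; E-irr = λ { (ne , _ , _) → ne refl } }
  where
  sw : (X : Graph) {a b : V X} → (a ≡ b) ⊎ E X a b → (b ≡ a) ⊎ E X b a
  sw X (inj₁ p) = inj₁ (sym p)
  sw X (inj₂ e) = inj₂ (E-sym X e)

joinE : (G H : Graph) → V G ⊎ V H → V G ⊎ V H → Set
joinE G H (inj₁ x) (inj₁ y) = E G x y
joinE G H (inj₁ x) (inj₂ y) = ⊤
joinE G H (inj₂ x) (inj₁ y) = ⊤
joinE G H (inj₂ x) (inj₂ y) = E H x y

_+ᴳ_ : Graph → Graph → Graph
G +ᴳ H = record
  { V = V G ⊎ V H ; E = joinE G H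
  ; E-sym = λ { {inj₁ x} {inj₁ y} e → E-sym G e
              ; {inj₁ x} {inj₂ y} e → tt
              ; {inj₂ x} {inj₁ y} e → tt
              ; {inj₂ x} {inj₂ y} e → E-sym H e }
  ; E-irr = λ { {inj₁ x} e → E-irr G e ; {inj₂ x} e → E-irr H e } }

induced : (G : Graph) → (V G → Set) → Graph
induced G P = record
  { V = Σ (V G) P ; E = λ x y → E G (proj₁ x) (proj₁ y)
  ; E-sym = E-sym G ; E-irr = E-irr G }

_⊆ᴳ_ : Graph → Graph → Set
G ⊆ᴳ H = Σ (V G → V H) λ f → Injective f × (∀ x y → E G x y → E H (f x) (f y))

data IsKTree (k : ℕ) : Graph → Set₁ where
  base : ∀ {G} → G ≅ K k → IsKTree k G
  step : ∀ {H G} → IsKTree k H → (Q : Fin k → V H) → IsCliqueMap H Q →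
         G ≅ addVertex H Q → IsKTree k G

IsSummand : ℕ → ℕ → Graph → Set₁
IsSummand k t F = Σ Graph λ H → IsKTree k H × Σ ℕ λ n → F ≅ ((H ⊠ Path n) +ᴳ K t)

-- G is obtained from the disjoint union of S and F by identifying
-- Q_S(i) with Q_F(i) for each i (characterised up to isomorphism:
-- G is covered by injective images of S and F which overlap exactly
-- in the identified cliques, and whose edges are exactly the images).
record IsGluing (S F : Graph) {q : ℕ} (QS : Fin q → V S) (QF : Fin q → V F)
                (G : Graph) : Set where
  field
    φ       : V S → V G
    ψ       : V F → V G
    φ-inj   : Injective φ
    ψ-inj   : Injective ψ
    glued   : ∀ i → φ (QS i) ≡ ψ (QF i)
    overlap-ok : ∀ a b → φ a ≡ ψ b → ∃[ i ] (a ≡ QS i × b ≡ QF i)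
    cover   : ∀ x → (∃[ a ] φ a ≡ x) ⊎ (∃[ b ] ψ b ≡ x)
    edges→  : ∀ x y → E G x y →
              (∃[ a ] ∃[ b ] (φ a ≡ x × φ b ≡ y × E S a b)) ⊎
              (∃[ a ] ∃[ b ] (ψ a ≡ x × ψ b ≡ y × E F a b))
    edgesS  : ∀ a b → E S a b → E G (φ a) (φ b)
    edgesF  : ∀ a b → E F a b → E G (ψ a) (ψ b)

data IsSum (w k t : ℕ) : Graph → Set₁ where
  summand : ∀ {F} → IsSummand k t F → IsSum w k t F
  glue    : ∀ {S F G} {q : ℕ} → IsSum w k t S → IsSummand k t F → q ≤ w →
            (QS : Fin q → V S) → IsCliqueMap S QS →
            (QF : Fin q → V F) → IsCliqueMap F QF →
            IsGluing S F QS QF G → IsSum w k t G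

-- Natural layerings. Layers are indexed from 0 (L_1 of the paper is the
-- layer with index 0); a layering is a map  layer : V S → ℕ.

data Reach (G : Graph) (P : V G → Set) : V G → V G → Set where
  here  : ∀ {x} → P x → Reach G P x x
  there : ∀ {x z y} → P x → E G x z → Reach G P z y → Reach G P x y

IsClique : (G : Graph) → (V G → Set) → Set
IsClique G P = ∀ u v → P u → P v → u ≢ v → E G u v

AtMost : {A : Set} → ℕ → (A → Set) → Set
AtMost {A} w P = Σ (List A) λ xs → length xs ≤ w × (∀ v → P v → v ∈ xs)

record NaturalLayering (w k t : ℕ) (S : Graph) : Set₁ where
  field
    layer : V S → ℕ
  attach : ℕ → V S → V S → Set
  attach i x v = (layer v ≡ i) ×
                 (∃[ y ] (Reach S (λ u → layer u ≡ suc i) x y × E S v y))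
  field
    N1 : IsSum 0 k t (induced S (λ v → layer v ≡ 0))
    N2 : ∀ i x → layer x ≡ suc i →
         IsClique S (attach i x) × AtMost w (attach i x)
    N3 : ∀ i → Σ Graph λ G → IsSum (w ∸ 1) k t G ×
                             (induced S (λ v → layer v ≡ i) ⊆ᴳ G)
    N4 : ∀ x y → E S x y →
         (layer x ≡ layer y) ⊎ (layer x ≡ suc (layer y)) ⊎ (layer y ≡ suc (layer x))

module Submission where

-- Induction along the construction of the sum; a single summand is one layer.  When a
-- summand F is glued onto S along a clique Q, the layers of Q span at most two consecutive
-- values (by N4), so all vertices of F − Q can be put on one layer j containing the top of
-- Q, chosen so that some vertex of Q lies strictly below j when Q ≠ ∅, and j = 0 only when
-- Q = ∅.  The other layers are unchanged.  Layer j becomes a subgraph of the old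
-- (w−1)-sum containing layer j of S glued to F along Q ∩ layer j, a clique of fewer than
-- |Q| ≤ w vertices.  A component of layer j either meets S, and then has the same
-- attachments as in S because Q ∩ layer j is a clique, or lies inside F − Q, and then
-- attaches only to Q.

open import Defs
open import Data.Nat using (ℕ; zero; suc; _≤_; _∸_; z≤n; s≤s; _≟_; _≤?_)
open import Data.Nat.Properties
  using (≤-refl; ≤-trans; ≰⇒≥; <-irrefl; m≤n⇒m≤1+n; ∸-monoˡ-≤; 1+n≢0; 1+n≢n; m≢1+n+m)
  renaming (≡-irrelevant to ℕ-≡-irrelevant)
open import Data.Fin using (Fin) renaming (zero to fz; suc to fs; _≟_ to _≟ᶠ_)
open import Data.Fin.Properties using (any?) renaming (suc-injective to fs-injective)
import Data.Maybe.Properties as Maybe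
import Data.Product.Properties as Product
import Data.Sum.Properties as Sum
open import Data.Product using (Σ; ∃-syntax; _×_; _,_; proj₁; proj₂)
open import Data.Sum using (_⊎_; inj₁; inj₂) renaming (map to ⊎-map)
open import Data.Empty using (⊥; ⊥-elim; ⊥-elim-irr)
open import Data.List using (length; map; allFin)
open import Data.List.Properties using (length-map; length-tabulate)
open import Data.List.Membership.Propositional using (_∈_)
open import Data.List.Membership.Propositional.Properties using (∈-map⁺; ∈-allFin)
open import Relation.Nullary using (¬_; Dec; yes; no)
open import Relation.Nullary.Decidable using (map′)
open import Relation.Unary using (Decidable)
open import Relation.Binary.Definitions using (DecidableEquality)
open import Relation.Binary.PropositionalEquality
open import Function using (_∘_; id)

≅-sym : ∀ {G H} → G ≅ H → H ≅ G
≅-sym {G} {H} i = record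
  { to = from ; from = to ; from∘to = to∘from ; to∘from = from∘to
  ; pres = λ x y e → refl' (from x) (from y) (subst₂ (E H) (sym (to∘from x)) (sym (to∘from y)) e)
  ; refl' = λ x y e → subst₂ (E H) (to∘from x) (to∘from y) (pres (from x) (from y) e) }
  where open _≅_ i

≅-trans : ∀ {G H J} → G ≅ H → H ≅ J → G ≅ J
≅-trans i j = record
  { to = J.to ∘ I.to ; from = I.from ∘ J.from
  ; from∘to = λ x → trans (cong I.from (J.from∘to (I.to x))) (I.from∘to x)
  ; to∘from = λ z → trans (cong J.to (I.to∘from (J.from z))) (J.to∘from z)
  ; pres = λ x y e → J.pres _ _ (I.pres _ _ e)
  ; refl' = λ x y e → I.refl' _ _ (J.refl' _ _ e) }
  where module I = _≅_ i
        module J = _≅_ j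

≅-to-injective : ∀ {G H} (i : G ≅ H) → Injective (_≅_.to i)
≅-to-injective i x y e = trans (sym (from∘to x)) (trans (cong from e) (from∘to y))
  where open _≅_ i

≅⇒⊆ᴳ : ∀ {G H} → G ≅ H → G ⊆ᴳ H
≅⇒⊆ᴳ i = _≅_.to i , ≅-to-injective i , _≅_.pres i

⊆ᴳ-trans : ∀ {G H J} → G ⊆ᴳ H → H ⊆ᴳ J → G ⊆ᴳ J
⊆ᴳ-trans (f , f-inj , f-pres) (g , g-inj , g-pres) =
  g ∘ f , (λ x y e → f-inj x y (g-inj _ _ e)) , (λ x y e → g-pres _ _ (f-pres x y e))

IsGluing-≅ : ∀ {S F G G'} {q} {QS : Fin q → V S} {QF : Fin q → V F} →
             IsGluing S F QS QF G → G ≅ G' → IsGluing S F QS QF G'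
IsGluing-≅ gl i = record
  { φ = I.to ∘ φ ; ψ = I.to ∘ ψ
  ; φ-inj = λ a b e → φ-inj a b (to-inj _ _ e)
  ; ψ-inj = λ a b e → ψ-inj a b (to-inj _ _ e)
  ; glued = λ k → cong I.to (glued k)
  ; overlap-ok = λ a b e → overlap-ok a b (to-inj _ _ e)
  ; cover = λ x → ⊎-map (back x) (back x) (cover (I.from x))
  ; edges→ = λ x y e → ⊎-map (back₂ x y) (back₂ x y)
      (edges→ (I.from x) (I.from y) (_≅_.pres (≅-sym i) x y e))
  ; edgesS = λ a b e → I.pres _ _ (edgesS a b e)
  ; edgesF = λ a b e → I.pres _ _ (edgesF a b e) }
  where
  module I = _≅_ i
  open IsGluing gl
  to-inj : Injective I.to
  to-inj = ≅-to-injective i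
  back : ∀ {A : Set} {f : A → _} x → ∃[ a ] f a ≡ I.from x → ∃[ a ] I.to (f a) ≡ x
  back x (a , e) = a , trans (cong I.to e) (I.to∘from x)
  back₂ : ∀ {A : Set} {f : A → _} {R : A → A → Set} x y →
          ∃[ a ] ∃[ b ] (f a ≡ I.from x × f b ≡ I.from y × R a b) →
          ∃[ a ] ∃[ b ] (I.to (f a) ≡ x × I.to (f b) ≡ y × R a b)
  back₂ x y (a , b , ea , eb , r) =
    a , b , trans (cong I.to ea) (I.to∘from x) , trans (cong I.to eb) (I.to∘from y) , r

IsSum-≅ : ∀ {w k t G G'} → IsSum w k t G → G ≅ G' → IsSum w k t G'
IsSum-≅ (summand (H , H-tree , n , j)) i = summand (H , H-tree , n , ≅-trans (≅-sym i) j)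
IsSum-≅ (glue s f q≤w QS cS QF cF gl) i = glue s f q≤w QS cS QF cF (IsGluing-≅ gl i)

≅-≟ : ∀ {G H} → G ≅ H → DecidableEquality (V H) → DecidableEquality (V G)
≅-≟ i _≟H_ x y = map′ (≅-to-injective i x y) (cong (_≅_.to i)) (_≅_.to i x ≟H _≅_.to i y)

IsKTree-≟ : ∀ {k H} → IsKTree k H → DecidableEquality (V H)
IsKTree-≟ (base i) = ≅-≟ i _≟ᶠ_
IsKTree-≟ (step h Q c i) = ≅-≟ i (Maybe.≡-dec (IsKTree-≟ h))

IsSummand-≟ : ∀ {k t F} → IsSummand k t F → DecidableEquality (V F)
IsSummand-≟ (H , H-tree , n , i) =
  ≅-≟ i (Sum.≡-dec (Product.≡-dec (IsKTree-≟ H-tree) _≟ᶠ_) _≟ᶠ_)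

on-layer-≡ : {A : Set} {ℓ : A → ℕ} {n : ℕ} {a b : A} {p : ℓ a ≡ n} {q : ℓ b ≡ n} →
             a ≡ b → _≡_ {A = Σ A (λ u → ℓ u ≡ n)} (a , p) (b , q)
on-layer-≡ {p = p} {q = q} refl = cong (_ ,_) (ℕ-≡-irrelevant p q)

reach-source : ∀ {G P x y} → Reach G P x y → P x
reach-source (here p) = p
reach-source (there p _ _) = p

reach-target : ∀ {G P x y} → Reach G P x y → P y
reach-target (here p) = p
reach-target (there _ _ r) = reach-target r

reach-snoc : ∀ {G P x y z} → Reach G P x y → E G y z → P z → Reach G P x z
reach-snoc (here p) e pz = there p e (here pz)
reach-snoc (there p e' r) e pz = there p e' (reach-snoc r e pz)

record Enumeration (q : ℕ) (P : Fin q → Set) : Set where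
  field
    size           : ℕ
    index          : Fin size → Fin q
    index-injective : Injective index
    index-sound    : ∀ i → P (index i)
    index-complete : ∀ i → P i → ∃[ i' ] index i' ≡ i
    size≤          : size ≤ q
    size<          : (∃[ i ] ¬ P i) → suc size ≤ q

module _ {q : ℕ} {P : Fin (suc q) → Set} (en : Enumeration q (P ∘ fs)) where
  open Enumeration en

  enumeration-keep : P fz → Enumeration (suc q) P
  enumeration-keep p = record
    { size = suc size ; index = index' ; index-injective = injective
    ; index-sound = sound ; index-complete = complete
    ; size≤ = s≤s size≤ ; size< = strict }
    where
    index' : Fin (suc size) → Fin (suc q)
    index' fz = fz
    index' (fs i) = fs (index i)
    injective : Injective index'
    injective fz fz e = refl
    injective (fs x) (fs y) e = cong fs (index-injective x y (fs-injective e))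
    sound : ∀ i → P (index' i)
    sound fz = p
    sound (fs i) = index-sound i
    complete : ∀ i → P i → ∃[ i' ] index' i' ≡ i
    complete fz _ = fz , refl
    complete (fs i) pi with index-complete i pi
    ... | i' , e = fs i' , cong fs e
    strict : (∃[ i ] ¬ P i) → suc (suc size) ≤ suc q
    strict (fz , ¬p) = ⊥-elim (¬p p)
    strict (fs i , ¬p) = s≤s (size< (i , ¬p))

  enumeration-skip : ¬ P fz → Enumeration (suc q) P
  enumeration-skip ¬p = record
    { size = size ; index = fs ∘ index
    ; index-injective = λ x y e → index-injective x y (fs-injective e)
    ; index-sound = index-sound ; index-complete = complete
    ; size≤ = m≤n⇒m≤1+n size≤ ; size< = λ _ → s≤s size≤ }
    where
    complete : ∀ i → P i → ∃[ i' ] fs (index i') ≡ i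
    complete fz pi = ⊥-elim (¬p pi)
    complete (fs i) pi with index-complete i pi
    ... | i' , e = i' , cong fs e

enumerate : ∀ q (P : Fin q → Set) → Decidable P → Enumeration q P
enumerate zero P P? = record
  { size = 0 ; index = λ () ; index-injective = λ () ; index-sound = λ () ; index-complete = λ ()
  ; size≤ = z≤n ; size< = λ { (() , _) } }
enumerate (suc q) P P? with P? fz
... | yes p = enumeration-keep (enumerate q (P ∘ fs) (P? ∘ fs)) p
... | no ¬p = enumeration-skip (enumerate q (P ∘ fs) (P? ∘ fs)) ¬p

argmax : ∀ q (ℓ : Fin (suc q) → ℕ) → ∃[ m ] (∀ i → ℓ i ≤ ℓ m)
argmax zero ℓ = fz , λ { fz → ≤-refl }
argmax (suc q) ℓ with argmax q (ℓ ∘ fs)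
... | m , max with ℓ fz ≤? ℓ (fs m)
...   | yes le = fs m , λ { fz → le ; (fs i) → max i }
...   | no ¬le = fz , λ { fz → ≤-refl ; (fs i) → ≤-trans (max i) (≰⇒≥ ¬le) }

Near : ℕ → ℕ → Set
Near m n = m ≡ n ⊎ m ≡ suc n ⊎ n ≡ suc m

record FreshLayer {q : ℕ} (ℓ : Fin q → ℕ) : Set where
  field
    j       : ℕ
    near-j  : ∀ i → ℓ i ≡ j ⊎ suc (ℓ i) ≡ j
    j≡0⇒q≡0 : j ≡ 0 → q ≡ 0
    below-j : q ≡ 0 ⊎ ∃[ i ] ℓ i ≢ j

freshLayer : ∀ {q} (ℓ : Fin q → ℕ) → (∀ i i' → i ≢ i' → Near (ℓ i) (ℓ i')) → FreshLayer ℓ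
freshLayer {zero} ℓ near =
  record { j = 0 ; near-j = λ () ; j≡0⇒q≡0 = λ _ → refl ; below-j = inj₁ refl }
freshLayer {suc q} ℓ near with argmax q ℓ
... | m , max = pick (any? (λ i → suc (ℓ i) ≟ ℓ m))
  where
  near-top : ∀ i → ℓ i ≡ ℓ m ⊎ suc (ℓ i) ≡ ℓ m
  near-top i with i ≟ᶠ m
  ... | yes refl = inj₁ refl
  ... | no i≢m with near i m i≢m
  ...   | inj₁ e = inj₁ e
  ...   | inj₂ (inj₁ e) = ⊥-elim (<-irrefl refl (subst (_≤ ℓ m) e (max i)))
  ...   | inj₂ (inj₂ e) = inj₂ (sym e)
  pick : Dec (∃[ i ] suc (ℓ i) ≡ ℓ m) → FreshLayer ℓ
  pick (yes (i , e)) = record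
    { j = ℓ m ; near-j = near-top ; j≡0⇒q≡0 = λ e' → ⊥-elim (1+n≢0 (trans e e'))
    ; below-j = inj₂ (i , λ e' → 1+n≢n (trans e (sym e'))) }
  pick (no ¬below) = record
    { j = suc (ℓ m) ; near-j = λ i → inj₂ (cong suc (all-top i)) ; j≡0⇒q≡0 = λ ()
    ; below-j = inj₂ (fz , λ e → <-irrefl e (s≤s (max fz))) }
    where
    all-top : ∀ i → ℓ i ≡ ℓ m
    all-top i with near-top i
    ... | inj₁ e = e
    ... | inj₂ e = ⊥-elim (¬below (i , e))

summand-layering : ∀ {w k t F} → IsSummand k t F → NaturalLayering w k t F
summand-layering {F = F} F-summand = record
  { layer = λ _ → 0
  ; N1 = IsSum-≅ (summand F-summand) (≅-sym layer₀≅F)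
  ; N2 = λ i x ()
  ; N3 = λ i → F , summand F-summand , proj₁ , (λ x y e → on-layer-≡ e) , (λ x y e → e)
  ; N4 = λ _ _ _ → inj₁ refl }
  where
  layer₀≅F : induced F (λ v → 0 ≡ 0) ≅ F
  layer₀≅F = record { to = proj₁ ; from = λ x → x , refl ; from∘to = λ x → on-layer-≡ refl
                    ; to∘from = λ _ → refl ; pres = λ _ _ e → e ; refl' = λ _ _ e → e }

-- The freshness proof is irrelevant, so a fresh vertex is determined by its vertex of F.
record Fresh (F : Graph) {q : ℕ} (QF : Fin q → V F) : Set where
  constructor fresh
  field
    vertex : V F
    .∉Q    : ¬ (∃[ i ] QF i ≡ vertex)

module Glue (A F : Graph) {q : ℕ} (QA : Fin q → V A) (QA-clique : IsCliqueMap A QA)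
            (QF : Fin q → V F) (QF-clique : IsCliqueMap F QF) (_≟F_ : DecidableEquality (V F)) where

  inQ? : ∀ b → Dec (∃[ i ] QF i ≡ b)
  inQ? b = any? (λ i → QF i ≟F b)

  Vglued : Set
  Vglued = V A ⊎ Fresh F QF

  E-glued : Vglued → Vglued → Set
  E-glued (inj₁ a) (inj₁ a') = E A a a'
  E-glued (inj₁ a) (inj₂ (fresh b _)) = ∃[ i ] (QA i ≡ a × E F (QF i) b)
  E-glued (inj₂ (fresh b _)) (inj₁ a) = ∃[ i ] (QA i ≡ a × E F (QF i) b)
  E-glued (inj₂ (fresh b _)) (inj₂ (fresh b' _)) = E F b b'

  E-glued-sym : ∀ {x y} → E-glued x y → E-glued y x
  E-glued-sym {inj₁ a} {inj₁ a'} e = E-sym A e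
  E-glued-sym {inj₁ a} {inj₂ _} e = e
  E-glued-sym {inj₂ _} {inj₁ a} e = e
  E-glued-sym {inj₂ _} {inj₂ _} e = E-sym F e

  E-glued-irr : ∀ {x} → ¬ E-glued x x
  E-glued-irr {inj₁ a} e = E-irr A e
  E-glued-irr {inj₂ _} e = E-irr F e

  graph : Graph
  graph = record { V = Vglued ; E = E-glued
                 ; E-sym = λ {x} {y} → E-glued-sym {x} {y} ; E-irr = λ {x} → E-glued-irr {x} }

  ψ-by : (b : V F) → Dec (∃[ i ] QF i ≡ b) → Vglued
  ψ-by b (yes (i , _)) = inj₁ (QA i)
  ψ-by b (no b∉Q) = inj₂ (fresh b b∉Q)

  ψ : V F → Vglued
  ψ b = ψ-by b (inQ? b)

  ψ-by-injective : ∀ b b' d d' → ψ-by b d ≡ ψ-by b' d' → b ≡ b'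
  ψ-by-injective b b' (yes (i , ei)) (yes (i' , ei')) e =
    trans (sym ei) (trans (cong QF (proj₁ QA-clique i i' (Sum.inj₁-injective e))) ei')
  ψ-by-injective b b' (no _) (no _) e = cong Fresh.vertex (Sum.inj₂-injective e)

  ψ-by-Q : ∀ i d → inj₁ (QA i) ≡ ψ-by (QF i) d
  ψ-by-Q i (yes (i' , e)) = cong (inj₁ ∘ QA) (proj₁ QF-clique i i' (sym e))
  ψ-by-Q i (no b∉Q) = ⊥-elim (b∉Q (i , refl))

  ψ-by-overlap : ∀ a b d → inj₁ a ≡ ψ-by b d → ∃[ i ] (a ≡ QA i × b ≡ QF i)
  ψ-by-overlap a b (yes (i , ei)) e = i , Sum.inj₁-injective e , sym ei

  ψ-by-fresh : ∀ b .(b∉Q : ¬ (∃[ i ] QF i ≡ b)) d → ψ-by b d ≡ inj₂ (fresh b b∉Q)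
  ψ-by-fresh b b∉Q (yes p) = ⊥-elim-irr (b∉Q p)
  ψ-by-fresh b b∉Q (no _) = refl

  ψ-by-edge : ∀ a b → E F a b → ∀ d d' → E-glued (ψ-by a d) (ψ-by b d')
  ψ-by-edge a b e (yes (i , ei)) (yes (i' , ei')) with i ≟ᶠ i'
  ... | yes refl = ⊥-elim (E-irr F (subst₂ (E F) (sym ei) (sym ei') e))
  ... | no i≢i' = proj₂ QA-clique i i' i≢i'
  ψ-by-edge a b e (yes (i , ei)) (no _) = i , refl , subst (λ z → E F z b) (sym ei) e
  ψ-by-edge a b e (no _) (yes (i , ei)) = i , refl , subst (λ z → E F z a) (sym ei) (E-sym F e)
  ψ-by-edge a b e (no _) (no _) = e

  ψ-Q : ∀ {i a} → QA i ≡ a → ψ (QF i) ≡ inj₁ a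
  ψ-Q {i} e = trans (sym (ψ-by-Q i (inQ? (QF i)))) (cong inj₁ e)

  edges-glued : ∀ x y → E-glued x y →
                (∃[ a ] ∃[ b ] (inj₁ a ≡ x × inj₁ b ≡ y × E A a b)) ⊎
                (∃[ a ] ∃[ b ] (ψ a ≡ x × ψ b ≡ y × E F a b))
  edges-glued (inj₁ a) (inj₁ a') e = inj₁ (a , a' , refl , refl , e)
  edges-glued (inj₁ a) (inj₂ (fresh b b∉Q)) (i , ei , e) =
    inj₂ (QF i , b , ψ-Q ei , ψ-by-fresh b b∉Q (inQ? b) , e)
  edges-glued (inj₂ (fresh b b∉Q)) (inj₁ a) (i , ei , e) =
    inj₂ (b , QF i , ψ-by-fresh b b∉Q (inQ? b) , ψ-Q ei , E-sym F e)
  edges-glued (inj₂ (fresh b b∉Q)) (inj₂ (fresh b' b'∉Q)) e =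
    inj₂ (b , b' , ψ-by-fresh b b∉Q (inQ? b) , ψ-by-fresh b' b'∉Q (inQ? b') , e)

  isGluing : IsGluing A F QA QF graph
  isGluing = record
    { φ = inj₁ ; ψ = ψ
    ; φ-inj = λ a b e → Sum.inj₁-injective e
    ; ψ-inj = λ a b e → ψ-by-injective a b (inQ? a) (inQ? b) e
    ; glued = λ i → ψ-by-Q i (inQ? (QF i))
    ; overlap-ok = λ a b e → ψ-by-overlap a b (inQ? b) e
    ; cover = λ { (inj₁ a) → inj₁ (a , refl)
                ; (inj₂ (fresh b b∉Q)) → inj₂ (b , ψ-by-fresh b b∉Q (inQ? b)) }
    ; edges→ = edges-glued
    ; edgesS = λ a b e → e
    ; edgesF = λ a b e → ψ-by-edge a b e (inQ? a) (inQ? b) }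

module Extend {w k t : ℕ} {S F G : Graph} {q : ℕ}
  (F-summand : IsSummand k t F) (q≤w : q ≤ w)
  (QS : Fin q → V S) (QS-clique : IsCliqueMap S QS) (QF : Fin q → V F) (QF-clique : IsCliqueMap F QF)
  (gl : IsGluing S F QS QF G) (L : NaturalLayering w k t S)
  (fl : FreshLayer (λ i → NaturalLayering.layer L (QS i))) where

  open IsGluing gl
  open NaturalLayering L
    renaming (layer to ℓS; attach to attachS; N1 to N1S; N2 to N2S; N3 to N3S; N4 to N4S)
  open FreshLayer fl

  _≟F_ : DecidableEquality (V F)
  _≟F_ = IsSummand-≟ F-summand

  OffQ : V F → Set
  OffQ b = ¬ (∃[ i ] QF i ≡ b)

  φ≢ψ : ∀ a b → OffQ b → φ a ≢ ψ b
  φ≢ψ a b b∉Q e with overlap-ok a b e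
  ... | i , _ , eb = b∉Q (i , sym eb)

  data Origin (x : V G) : Set where
    fromS : ∀ a → φ a ≡ x → Origin x
    fromF : ∀ b → OffQ b → ψ b ≡ x → Origin x

  origin : ∀ x → Origin x
  origin x with cover x
  ... | inj₁ (a , e) = fromS a e
  ... | inj₂ (b , e) with any? (λ i → QF i ≟F b)
  ...   | yes (i , e') = fromS (QS i) (trans (glued i) (trans (cong ψ e') e))
  ...   | no b∉Q = fromF b b∉Q e

  layer-of : ∀ {x} → Origin x → ℕ
  layer-of (fromS a _) = ℓS a
  layer-of (fromF _ _ _) = j

  ℓG : V G → ℕ
  ℓG x = layer-of (origin x)

  ℓG-φ : ∀ a → ℓG (φ a) ≡ ℓS a
  ℓG-φ a = layer-of-φ (origin (φ a))
    where
    layer-of-φ : (o : Origin (φ a)) → layer-of o ≡ ℓS a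
    layer-of-φ (fromS a' e) = cong ℓS (φ-inj a' a e)
    layer-of-φ (fromF b b∉Q e) = ⊥-elim (φ≢ψ a b b∉Q (sym e))

  ℓG-ψ : ∀ b → OffQ b → ℓG (ψ b) ≡ j
  ℓG-ψ b b∉Q = layer-of-ψ (origin (ψ b))
    where
    layer-of-ψ : (o : Origin (ψ b)) → layer-of o ≡ j
    layer-of-ψ (fromS a e) = ⊥-elim (φ≢ψ a b b∉Q e)
    layer-of-ψ (fromF _ _ _) = refl

  φ-layer : ∀ {a x n} → φ a ≡ x → ℓG x ≡ n → ℓS a ≡ n
  φ-layer {a} refl p = trans (sym (ℓG-φ a)) p

  data View (x : V G) : Set where
    old : ∀ a → φ a ≡ x → ℓG x ≡ ℓS a → View x
    new : ∀ b → OffQ b → ψ b ≡ x → ℓG x ≡ j → View x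

  layerS : ℕ → Graph
  layerS i = induced S (λ v → ℓS v ≡ i)

  layerG : ℕ → Graph
  layerG i = induced G (λ v → ℓG v ≡ i)

  view : ∀ x → View x
  view x with origin x
  ... | fromS a refl = old a refl (ℓG-φ a)
  ... | fromF b b∉Q refl = new b b∉Q refl (ℓG-ψ b b∉Q)

  E-old : ∀ a a' → E G (φ a) (φ a') → E S a a'
  E-old a a' e with edges→ (φ a) (φ a') e
  ... | inj₁ (a₁ , a₂ , e₁ , e₂ , es) = subst₂ (E S) (φ-inj _ _ e₁) (φ-inj _ _ e₂) es
  ... | inj₂ (b₁ , b₂ , e₁ , e₂ , ef) with overlap-ok a b₁ (sym e₁) | overlap-ok a' b₂ (sym e₂)
  ...   | i , ea , eb | i' , ea' , eb' with i ≟ᶠ i'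
  ...     | yes refl = ⊥-elim (E-irr F (subst₂ (E F) eb eb' ef))
  ...     | no i≢i' = subst₂ (E S) (sym ea) (sym ea') (proj₂ QS-clique i i' i≢i')

  E-old-new : ∀ a b → OffQ b → E G (φ a) (ψ b) → ∃[ i ] (a ≡ QS i × E F (QF i) b)
  E-old-new a b b∉Q e with edges→ (φ a) (ψ b) e
  ... | inj₁ (_ , a₂ , _ , e₂ , _) = ⊥-elim (φ≢ψ a₂ b b∉Q e₂)
  ... | inj₂ (b₁ , b₂ , e₁ , e₂ , ef) with overlap-ok a b₁ (sym e₁)
  ...   | i , ea , eb = i , ea , subst₂ (E F) eb (ψ-inj b₂ b e₂) ef

  E-new : ∀ b b' → OffQ b → E G (ψ b) (ψ b') → E F b b'
  E-new b b' b∉Q e with edges→ (ψ b) (ψ b') e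
  ... | inj₁ (a₁ , _ , e₁ , _ , _) = ⊥-elim (φ≢ψ a₁ b b∉Q e₁)
  ... | inj₂ (b₁ , b₂ , e₁ , e₂ , ef) = subst₂ (E F) (ψ-inj b₁ b e₁) (ψ-inj b₂ b' e₂) ef

  N4G : ∀ x y → E G x y → Near (ℓG x) (ℓG y)
  N4G x y e with view x | view y
  ... | old a refl p | old a' refl p' = subst₂ Near (sym p) (sym p') (N4S a a' (E-old a a' e))
  ... | old a refl p | new b b∉Q refl p' with E-old-new a b b∉Q e
  ...   | i , refl , _ with near-j i
  ...     | inj₁ eq = inj₁ (trans p (trans eq (sym p')))
  ...     | inj₂ eq = inj₂ (inj₂ (trans p' (trans (sym eq) (cong suc (sym p)))))
  N4G x y e | new b b∉Q refl p | old a refl p' with E-old-new a b b∉Q (E-sym G e)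
  ...   | i , refl , _ with near-j i
  ...     | inj₁ eq = inj₁ (trans p (trans (sym eq) (sym p')))
  ...     | inj₂ eq = inj₂ (inj₁ (trans p (trans (sym eq) (cong suc (sym p')))))
  N4G x y e | new b _ refl p | new b' _ refl p' = inj₁ (trans p (sym p'))

  φ-on-layer : ∀ {i} → V (layerS i) → V (layerG i)
  φ-on-layer (a , a∈) = φ a , trans (ℓG-φ a) a∈

  module Unchanged (i : ℕ) (i≢j : i ≢ j) where
    from-view : ∀ x → ℓG x ≡ i → View x → V (layerS i)
    from-view x x∈ (old a _ ℓ≡) = a , trans (sym ℓ≡) x∈
    from-view x x∈ (new _ _ _ ℓ≡j) = ⊥-elim (i≢j (trans (sym x∈) ℓ≡j))

    from-to : ∀ a (a∈ : ℓS a ≡ i) x∈ v → from-view (φ a) x∈ v ≡ (a , a∈)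
    from-to a a∈ x∈ (old a' e _) = on-layer-≡ (φ-inj a' a e)
    from-to a a∈ x∈ (new _ _ _ ℓ≡j) = ⊥-elim (i≢j (trans (sym x∈) ℓ≡j))

    to-from : ∀ x (x∈ : ℓG x ≡ i) v → φ-on-layer (from-view x x∈ v) ≡ (x , x∈)
    to-from x x∈ (old a e _) = on-layer-≡ e
    to-from x x∈ (new _ _ _ ℓ≡j) = ⊥-elim (i≢j (trans (sym x∈) ℓ≡j))

    layer≅ : layerS i ≅ layerG i
    layer≅ = record
      { to = φ-on-layer
      ; from = λ { (x , x∈) → from-view x x∈ (view x) }
      ; from∘to = λ { (a , a∈) → from-to a a∈ _ (view (φ a)) }
      ; to∘from = λ { (x , x∈) → to-from x x∈ (view x) }
      ; pres = λ { (a , _) (a' , _) e → edgesS a a' e }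
      ; refl' = λ { (a , _) (a' , _) e → E-old a a' e } }

    layer⊆ : ∀ {H} → layerS i ⊆ᴳ H → layerG i ⊆ᴳ H
    layer⊆ {H} = ⊆ᴳ-trans {layerG i} {layerS i} {H} (≅⇒⊆ᴳ (≅-sym layer≅))

  -- If j = 0 then Q = ∅, so layer 0 of G is the disjoint union of layer 0 of S and F.
  module AtLayer0 (j≡0 : j ≡ 0) where
    Q-empty : Fin q → ⊥
    Q-empty = empty (j≡0⇒q≡0 j≡0)
      where
      empty : q ≡ 0 → Fin q → ⊥
      empty refl ()

    ψ₀ : V F → V (layerG 0)
    ψ₀ b = ψ b , trans (ℓG-ψ b (Q-empty ∘ proj₁)) j≡0

    cover₀ : ∀ x → (∃[ a ] φ-on-layer a ≡ x) ⊎ (∃[ b ] ψ₀ b ≡ x)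
    cover₀ (x , x∈) with view x
    ... | old a e ℓ≡ = inj₁ ((a , trans (sym ℓ≡) x∈) , on-layer-≡ e)
    ... | new b _ e _ = inj₂ (b , on-layer-≡ e)

    edges₀ : ∀ x y → E (layerG 0) x y →
             (∃[ a ] ∃[ b ] (φ-on-layer a ≡ x × φ-on-layer b ≡ y × E (layerS 0) a b)) ⊎
             (∃[ a ] ∃[ b ] (ψ₀ a ≡ x × ψ₀ b ≡ y × E F a b))
    edges₀ (x , x∈) (y , y∈) e with view x | view y
    ... | old a refl ℓ≡ | old a' refl ℓ≡' =
          inj₁ ((a , trans (sym ℓ≡) x∈) , (a' , trans (sym ℓ≡') y∈) ,
                on-layer-≡ refl , on-layer-≡ refl , E-old a a' e)
    ... | old a refl _ | new b b∉Q refl _ = ⊥-elim (Q-empty (proj₁ (E-old-new a b b∉Q e)))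
    ... | new b b∉Q refl _ | old a refl _ = ⊥-elim (Q-empty (proj₁ (E-old-new a b b∉Q (E-sym G e))))
    ... | new b b∉Q refl _ | new b' _ refl _ =
          inj₂ (b , b' , on-layer-≡ refl , on-layer-≡ refl , E-new b b' b∉Q e)

    gluing₀ : IsGluing (layerS 0) F {0} (λ ()) (λ ()) (layerG 0)
    gluing₀ = record
      { φ = φ-on-layer ; ψ = ψ₀
      ; φ-inj = λ { (a , _) (a' , _) e → on-layer-≡ (φ-inj a a' (cong proj₁ e)) }
      ; ψ-inj = λ b b' e → ψ-inj b b' (cong proj₁ e)
      ; glued = λ ()
      ; overlap-ok = λ { (a , _) b e → ⊥-elim (φ≢ψ a b (Q-empty ∘ proj₁) (cong proj₁ e)) }
      ; cover = cover₀
      ; edges→ = edges₀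
      ; edgesS = λ { (a , _) (a' , _) e → edgesS a a' e }
      ; edgesF = edgesF }

    layer₀-sum : IsSum 0 k t (layerG 0)
    layer₀-sum = glue N1S F-summand z≤n (λ ()) ((λ ()) , (λ ())) (λ ()) ((λ ()) , (λ ())) gluing₀

  N1G : IsSum 0 k t (layerG 0)
  N1G with j ≟ 0
  ... | yes j≡0 = AtLayer0.layer₀-sum j≡0
  ... | no j≢0 = IsSum-≅ N1S (Unchanged.layer≅ 0 (j≢0 ∘ sym))

  module LayerJ where
    G-old : Graph
    G-old = proj₁ (N3S j)

    G-old-sum : IsSum (w ∸ 1) k t G-old
    G-old-sum = proj₁ (proj₂ (N3S j))

    Sj⊆G-old : layerS j ⊆ᴳ G-old
    Sj⊆G-old = proj₂ (proj₂ (N3S j))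

    f : V (layerS j) → V G-old
    f = proj₁ Sj⊆G-old

    f-injective : Injective f
    f-injective = proj₁ (proj₂ Sj⊆G-old)

    f-edge : ∀ x y → E (layerS j) x y → E G-old (f x) (f y)
    f-edge = proj₂ (proj₂ Sj⊆G-old)

    open Enumeration (enumerate q (λ i → ℓS (QS i) ≡ j) (λ i → ℓS (QS i) ≟ j))

    QA : Fin size → V G-old
    QA i = f (QS (index i) , index-sound i)

    QA-clique : IsCliqueMap G-old QA
    QA-clique = (λ x y e → index-injective x y (proj₁ QS-clique _ _ (cong proj₁ (f-injective _ _ e))))
              , (λ x y x≢y → f-edge _ _ (proj₂ QS-clique (index x) (index y) (x≢y ∘ index-injective x y)))

    QFj : Fin size → V F
    QFj = QF ∘ index

    QFj-clique : IsCliqueMap F QFj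
    QFj-clique = (λ x y e → index-injective x y (proj₁ QF-clique _ _ e))
               , (λ x y x≢y → proj₂ QF-clique (index x) (index y) (x≢y ∘ index-injective x y))

    size≤w∸1 : size ≤ w ∸ 1
    size≤w∸1 with below-j
    ... | inj₁ q≡0 = ≤-trans (subst (size ≤_) q≡0 size≤) z≤n
    ... | inj₂ below = ∸-monoˡ-≤ 1 (≤-trans (size< below) q≤w)

    module Glued = Glue G-old F QA QA-clique QFj QFj-clique _≟F_

    glued-sum : IsSum (w ∸ 1) k t Glued.graph
    glued-sum = glue G-old-sum F-summand size≤w∸1 QA QA-clique QFj QFj-clique Glued.isGluing

    embed-view : ∀ x → ℓG x ≡ j → View x → V Glued.graph
    embed-view x x∈ (old a _ ℓ≡) = inj₁ (f (a , trans (sym ℓ≡) x∈))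
    embed-view x x∈ (new b b∉Q _ _) = inj₂ (fresh b (λ { (i , e) → b∉Q (index i , e) }))

    embed-view-injective : ∀ x x' x∈ x'∈ v v' →
                           embed-view x x∈ v ≡ embed-view x' x'∈ v' → x ≡ x'
    embed-view-injective x x' _ _ (old a e _) (old a' e' _) eq =
      trans (sym e) (trans (cong (φ ∘ proj₁) (f-injective _ _ (Sum.inj₁-injective eq))) e')
    embed-view-injective x x' _ _ (new b _ e _) (new b' _ e' _) eq =
      trans (sym e) (trans (cong (ψ ∘ Fresh.vertex) (Sum.inj₂-injective eq)) e')

    embed-view-edge : ∀ x x' x∈ x'∈ v v' → E G x x' →
                      Glued.E-glued (embed-view x x∈ v) (embed-view x' x'∈ v')
    embed-view-edge x x' _ _ (old a refl _) (old a' refl _) e = f-edge _ _ (E-old a a' e)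
    embed-view-edge x x' x∈ _ (old a refl ℓ≡) (new b b∉Q refl _) e with E-old-new a b b∉Q e
    ... | i , refl , ef with index-complete i (trans (sym ℓ≡) x∈)
    ...   | i' , refl = i' , cong f (on-layer-≡ refl) , ef
    embed-view-edge x x' _ x'∈ (new b b∉Q refl _) (old a refl ℓ≡) e with E-old-new a b b∉Q (E-sym G e)
    ... | i , refl , ef with index-complete i (trans (sym ℓ≡) x'∈)
    ...   | i' , refl = i' , cong f (on-layer-≡ refl) , ef
    embed-view-edge x x' _ _ (new b b∉Q refl _) (new b' _ refl _) e = E-new b b' b∉Q e

    layer⊆glued : layerG j ⊆ᴳ Glued.graph
    layer⊆glued = (λ { (x , x∈) → embed-view x x∈ (view x) })
                , (λ { (x , x∈) (x' , x'∈) eq →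
                         on-layer-≡ (embed-view-injective x x' x∈ x'∈ (view x) (view x') eq) })
                , (λ { (x , x∈) (x' , x'∈) e → embed-view-edge x x' x∈ x'∈ (view x) (view x') e })

  N3G : ∀ i → Σ Graph λ G' → IsSum (w ∸ 1) k t G' × (layerG i ⊆ᴳ G')
  N3G i with i ≟ j
  ... | yes refl = LayerJ.Glued.graph , LayerJ.glued-sum , LayerJ.layer⊆glued
  ... | no i≢j with N3S i
  ...   | G' , G'-sum , Si⊆G' = G' , G'-sum , Unchanged.layer⊆ i i≢j {G'} Si⊆G'

  module Attach (i : ℕ) where
    OnG : V G → Set
    OnG u = ℓG u ≡ suc i

    OnS : V S → Set
    OnS u = ℓS u ≡ suc i

    attachG : V G → V G → Set
    attachG x v = (ℓG v ≡ i) × (∃[ y ] (Reach G OnG x y × E G v y))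

    N2-at : V G → Set
    N2-at x = IsClique G (attachG x) × AtMost w (attachG x)

    AttachedAsIn : V G → V S → Set
    AttachedAsIn x a = ∀ v → attachG x v → ∃[ a' ] (φ a' ≡ v × attachS i a a')

    N2-from-S : ∀ x a → OnS a → AttachedAsIn x a → N2-at x
    N2-from-S x a a∈ attached with N2S i a a∈
    ... | clique , (xs , |xs|≤w , complete) =
          clique' , (map φ xs , subst (_≤ w) (sym (length-map φ xs)) |xs|≤w , complete')
      where
      clique' : IsClique G (attachG x)
      clique' u v u∈ v∈ u≢v with attached u u∈ | attached v v∈
      ... | a₁ , refl , at₁ | a₂ , refl , at₂ = edgesS a₁ a₂ (clique a₁ a₂ at₁ at₂ (u≢v ∘ cong φ))
      complete' : ∀ v → attachG x v → v ∈ map φ xs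
      complete' v v∈ with attached v v∈
      ... | a₁ , refl , at₁ = ∈-map⁺ φ (complete a₁ at₁)

    N2-from-Q : ∀ x → (∀ v → attachG x v → ∃[ i' ] φ (QS i') ≡ v) → N2-at x
    N2-from-Q x attached = clique , (map (φ ∘ QS) (allFin q) , length≤w , complete)
      where
      clique : IsClique G (attachG x)
      clique u v u∈ v∈ u≢v with attached u u∈ | attached v v∈
      ... | i₁ , refl | i₂ , refl = edgesS _ _ (proj₂ QS-clique i₁ i₂ (u≢v ∘ cong (φ ∘ QS)))
      length≤w : length (map (φ ∘ QS) (allFin q)) ≤ w
      length≤w = subst (_≤ w) (sym (trans (length-map (φ ∘ QS) (allFin q)) (length-tabulate id))) q≤w
      complete : ∀ v → attachG x v → v ∈ map (φ ∘ QS) (allFin q)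
      complete v v∈ with attached v v∈
      ... | i₁ , refl = ∈-map⁺ (φ ∘ QS) (∈-allFin i₁)

    module OffJ (si≢j : suc i ≢ j) where
      lift-reach : ∀ {x y} → Reach G OnG x y → ∀ a → φ a ≡ x →
                   ∃[ a' ] (φ a' ≡ y × Reach S OnS a a')
      lift-reach (here x∈) a e = a , e , here (φ-layer e x∈)
      lift-reach (there {z = z} x∈ e r) a refl with view z
      ... | new _ _ _ ℓ≡j = ⊥-elim (si≢j (trans (sym (reach-source r)) ℓ≡j))
      ... | old c refl _ with lift-reach r c refl
      ...   | a' , e' , r' = a' , e' , there (φ-layer refl x∈) (E-old a c e) r'

      Q-not-above : ∀ i₀ → OnS (QS i₀) → i ≢ j
      Q-not-above i₀ i₀∈ i≡j with near-j i₀
      ... | inj₁ eq = 1+n≢n (trans (sym i₀∈) (trans eq (sym i≡j)))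
      ... | inj₂ eq = m≢1+n+m i {1} (sym (trans (cong suc (sym i₀∈)) (trans eq (sym i≡j))))

      attached-as-in-S : ∀ x → OnG x → ∃[ a ] (OnS a × AttachedAsIn x a)
      attached-as-in-S x x∈ with view x
      ... | new _ _ _ ℓ≡j = ⊥-elim (si≢j (trans (sym x∈) ℓ≡j))
      ... | old a refl _ = a , φ-layer refl x∈ , attached
        where
        attached : AttachedAsIn (φ a) a
        attached v (v∈ , y , r , e) with lift-reach r a refl | view v
        ... | a' , refl , r' | old a'' refl ℓ≡ = a'' , refl , (trans (sym ℓ≡) v∈ , a' , r' , E-old a'' a' e)
        ... | a' , refl , r' | new b b∉Q refl ℓ≡j with E-old-new a' b b∉Q (E-sym G e)
        ...   | i₀ , refl , _ = ⊥-elim (Q-not-above i₀ (reach-target r') (trans (sym v∈) ℓ≡j))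

    module AtJ (si≡j : suc i ≡ j) where
      layer-i≢j : ∀ {v} → ℓG v ≡ i → ℓG v ≢ j
      layer-i≢j v∈ ℓ≡j = 1+n≢n (trans si≡j (trans (sym ℓ≡j) v∈))

      ReachesQ : V S → Set
      ReachesQ a = (∃[ i₀ ] OnS (QS i₀)) × (∀ i₁ → OnS (QS i₁) → Reach S OnS a (QS i₁))

      reaches-Q : ∀ {a i₀} → Reach S OnS a (QS i₀) → ∀ i₁ → OnS (QS i₁) → Reach S OnS a (QS i₁)
      reaches-Q {i₀ = i₀} r i₁ i₁∈ with i₀ ≟ᶠ i₁
      ... | yes refl = r
      ... | no i₀≢i₁ = reach-snoc r (proj₂ QS-clique i₀ i₁ i₀≢i₁) i₁∈

      -- A walk in layer j starting in the component of a in S can only enter F − Q through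
      -- the clique Q ∩ layer j, which then lies entirely in that component.
      data Tracked (a : V S) (y : V G) : Set where
        inS : ∀ a' → φ a' ≡ y → Reach S OnS a a' → Tracked a y
        inF : ∀ b → OffQ b → ψ b ≡ y → ReachesQ a → Tracked a y

      tracked-step : ∀ a {y z} → Tracked a y → E G y z → OnG z → Tracked a z
      tracked-step a {z = z} (inS a' refl r) e z∈ with view z
      ... | old c refl _ = inS c refl (reach-snoc r (E-old a' c e) (φ-layer refl z∈))
      ... | new b b∉Q refl _ with E-old-new a' b b∉Q e
      ...   | i₁ , refl , _ = inF b b∉Q refl ((i₁ , reach-target r) , reaches-Q r)
      tracked-step a {z = z} (inF b b∉Q refl reach) e z∈ with view z
      ... | old c refl _ with E-old-new c b b∉Q (E-sym G e)
      ...   | i₁ , refl , _ = inS (QS i₁) refl (proj₂ reach i₁ (φ-layer refl z∈))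
      tracked-step a (inF b b∉Q refl reach) e z∈ | new b' b'∉Q refl _ = inF b' b'∉Q refl reach

      tracked-reach : ∀ a {y z} → Reach G OnG y z → Tracked a y → Tracked a z
      tracked-reach a (here _) tr = tr
      tracked-reach a (there _ e r) tr = tracked-reach a r (tracked-step a tr e (reach-source r))

      tracked-attach : ∀ a v → ℓG v ≡ i → ∀ y → Tracked a y → E G v y →
                       ∃[ a'' ] (φ a'' ≡ v × attachS i a a'')
      tracked-attach a v v∈ y tr e with view v
      ... | new _ _ _ ℓ≡j = ⊥-elim (layer-i≢j v∈ ℓ≡j)
      tracked-attach a v v∈ y (inS a' refl r) e | old a'' refl ℓ≡ =
        a'' , refl , (trans (sym ℓ≡) v∈ , a' , r , E-old a'' a' e)
      tracked-attach a v v∈ y (inF b b∉Q refl ((i₀ , i₀∈) , reach)) e | old a'' refl ℓ≡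
        with E-old-new a'' b b∉Q e
      ... | i₁ , refl , _ =
            QS i₁ , refl , (trans (sym ℓ≡) v∈ , QS i₀ , reach i₀ i₀∈ , proj₂ QS-clique i₁ i₀ i₁≢i₀)
        where
        i₁≢i₀ : i₁ ≢ i₀
        i₁≢i₀ refl = 1+n≢n (trans (sym i₀∈) (trans (sym ℓ≡) v∈))

      attached-as-in : ∀ a x → Tracked a x → AttachedAsIn x a
      attached-as-in a x tr v (v∈ , y , r , e) = tracked-attach a v v∈ y (tracked-reach a r tr) e

      NewOnly : V G → Set
      NewOnly y = ∃[ b ] (OffQ b × ψ b ≡ y)

      stays-new : ¬ (∃[ i₀ ] OnS (QS i₀)) → ∀ {y z} → Reach G OnG y z → NewOnly y → NewOnly z
      stays-new none (here _) n = n
      stays-new none (there {z = z} _ e r) (b , b∉Q , refl) = stays-new none r (new-step (view z))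
        where
        new-step : View z → NewOnly z
        new-step (new b' b'∉Q e' _) = b' , b'∉Q , e'
        new-step (old c refl _) with E-old-new c b b∉Q (E-sym G e)
        ... | i₁ , refl , _ = ⊥-elim (none (i₁ , φ-layer refl (reach-source r)))

      N2-at-j : ∀ x → OnG x → N2-at x
      N2-at-j x x∈ with view x
      ... | old a refl _ =
            N2-from-S x a (φ-layer refl x∈) (attached-as-in a x (inS a refl (here (φ-layer refl x∈))))
      ... | new b b∉Q refl _ with any? (λ i₀ → ℓS (QS i₀) ≟ suc i)
      ...   | yes (i₀ , i₀∈) =
              N2-from-S x (QS i₀) i₀∈
                (attached-as-in (QS i₀) x (inF b b∉Q refl ((i₀ , i₀∈) , reaches-Q (here i₀∈))))
      ...   | no none = N2-from-Q x attached
        where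
        attached : ∀ v → attachG x v → ∃[ i' ] φ (QS i') ≡ v
        attached v (v∈ , y , r , e) with stays-new none r (b , b∉Q , refl) | view v
        ... | _ | new _ _ _ ℓ≡j = ⊥-elim (layer-i≢j v∈ ℓ≡j)
        ... | b' , b'∉Q , refl | old a refl _ with E-old-new a b' b'∉Q e
        ...   | i₁ , refl , _ = i₁ , refl

  N2G : ∀ i x → ℓG x ≡ suc i → Attach.N2-at i x
  N2G i x x∈ with suc i ≟ j
  ... | yes si≡j = Attach.AtJ.N2-at-j i si≡j x x∈
  ... | no si≢j with Attach.OffJ.attached-as-in-S i si≢j x x∈
  ...   | a , a∈ , attached = Attach.N2-from-S i x a a∈ attached

  layering : NaturalLayering w k t G
  layering = record { layer = ℓG ; N1 = N1G ; N2 = N2G ; N3 = N3G ; N4 = N4G }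

lemma8 : (w k t : ℕ) → 1 ≤ w → (S : Graph) → IsSum w k t S → NaturalLayering w k t S
lemma8 w k t 1≤w S (summand F-summand) = summand-layering F-summand
lemma8 w k t 1≤w G (glue {S} sum-S F-summand q≤w QS QS-clique QF QF-clique gluing) =
  Extend.layering F-summand q≤w QS QS-clique QF QF-clique gluing L
    (freshLayer (layer ∘ QS) (λ i i' i≢i' → N4 (QS i) (QS i') (proj₂ QS-clique i i' i≢i')))
  where
  L : NaturalLayering w k t S
  L = lemma8 w k t 1≤w S sum-S
  open NaturalLayering L using (layer; N4)
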